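{- Let $p\in\omega_4$ and $\lambda\in\mathbb{F}_3^4$, $\lambda\neq0000$. Then $L_p^\lambda:=\{p,A_\lambda p,A_{2\lambda}p\}$ is a line of $\operatorname{PG}(7,2)$ contained in $\omega_4$ if and only if $\lambda\in\Xi\cup\Xi^*$ or $-\lambda\in\Xi\cup\Xi^*$, where $\Xi=\{1111,1221,2121,2211\}$ and $\Xi^*=\{2221,2111,1211,1121\}$.
   Context: Work over $\mathbb{F}_2$. $V_8=V(8,2)$ with basis $e_1,\dots,e_8$, $V_a=\langle e_1,e_8\rangle$, $V_b=\langle e_2,e_7\rangle$, $V_c=\langle e_3,e_6\rangle$, $V_d=\langle e_4,e_5\rangle$; points of $\operatorname{PG}(7,2)$ are nonzero vectors; $\omega_4$ is the set of vectors all four of whose components in $V_a,\dots,V_d$ are nonzero. Let $\zeta_a: e_1\mapsto e_8\mapsto e_1+e_8\mapsto e_1$, $\zeta_b: e_7\mapsto e_2\mapsto e_2+e_7\mapsto e_7$, $\zeta_c: e_3\mapsto e_6\mapsto e_3+e_6\mapsto e_3$, $\zeta_d: e_5\mapsto e_4\mapsto e_4+e_5\mapsto e_5$ (order-3 elements of $\operatorname{GL}(V_h)$). For $\lambda=ijkl\in\mathbb{F}_3^4$ (with $\mathbb{F}_3=\{0,1,2\}$) let $A_\lambda=\zeta_a^i\oplus\zeta_b^j\oplus\zeta_c^k\oplus\zeta_d^l$. A set of three points is a line iff they are distinct and sum to $0$. -}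

module Defs where

open import Data.Bool using (Bool; true; false; _xor_)
open import Data.Fin using (Fin; zero; suc)
open import Data.Vec using (Vec; []; _∷_; replicate; zipWith; map)
open import Data.List using (List; []; _∷_)
open import Data.Product using (_×_)
open import Relation.Binary.PropositionalEquality using (_≡_; _≢_)

-- F_2 is Bool with xor as addition.
-- V_8 = F_2^8; a vector x is the list of its coordinates (x1,…,x8)
-- with respect to the basis e_1,…,e_8.
V8 : Set
V8 = Vec Bool 8

zeroV : V8
zeroV = replicate 8 false

_⊕_ : V8 → V8 → V8
_⊕_ = zipWith _xor_

infixl 6 _⊕_

IsPoint : V8 → Set
IsPoint x = x ≢ zeroV

NonzeroPair : Bool → Bool → Set
NonzeroPair x y = (x ≡ true) Data.Sum.⊎ (y ≡ true)
  where import Data.Sum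

-- ω_4: all four components in V_a=<e1,e8>, V_b=<e2,e7>, V_c=<e3,e6>,
-- V_d=<e4,e5> are nonzero.
ω₄ : V8 → Set
ω₄ (x1 ∷ x2 ∷ x3 ∷ x4 ∷ x5 ∷ x6 ∷ x7 ∷ x8 ∷ []) =
  NonzeroPair x1 x8 × NonzeroPair x2 x7 × NonzeroPair x3 x6 × NonzeroPair x4 x5

-- The linear maps ζ_h, extended by the identity on the other components.
-- ζ_a : e1 ↦ e8, e8 ↦ e1+e8   (so x1 e1 + x8 e8 ↦ x8 e1 + (x1+x8) e8)
ζa : V8 → V8
ζa (x1 ∷ x2 ∷ x3 ∷ x4 ∷ x5 ∷ x6 ∷ x7 ∷ x8 ∷ []) =
  x8 ∷ x2 ∷ x3 ∷ x4 ∷ x5 ∷ x6 ∷ x7 ∷ (x1 xor x8) ∷ []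

-- ζ_b : e7 ↦ e2, e2 ↦ e2+e7   (so x2 e2 + x7 e7 ↦ (x2+x7) e2 + x2 e7)
ζb : V8 → V8
ζb (x1 ∷ x2 ∷ x3 ∷ x4 ∷ x5 ∷ x6 ∷ x7 ∷ x8 ∷ []) =
  x1 ∷ (x2 xor x7) ∷ x3 ∷ x4 ∷ x5 ∷ x6 ∷ x2 ∷ x8 ∷ []

-- ζ_c : e3 ↦ e6, e6 ↦ e3+e6   (so x3 e3 + x6 e6 ↦ x6 e3 + (x3+x6) e6)
ζc : V8 → V8
ζc (x1 ∷ x2 ∷ x3 ∷ x4 ∷ x5 ∷ x6 ∷ x7 ∷ x8 ∷ []) =
  x1 ∷ x2 ∷ x6 ∷ x4 ∷ x5 ∷ (x3 xor x6) ∷ x7 ∷ x8 ∷ []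

-- ζ_d : e5 ↦ e4, e4 ↦ e4+e5   (so x4 e4 + x5 e5 ↦ (x4+x5) e4 + x4 e5)
ζd : V8 → V8
ζd (x1 ∷ x2 ∷ x3 ∷ x4 ∷ x5 ∷ x6 ∷ x7 ∷ x8 ∷ []) =
  x1 ∷ x2 ∷ x3 ∷ (x4 xor x5) ∷ x4 ∷ x6 ∷ x7 ∷ x8 ∷ []

F3 : Set
F3 = Fin 3

pow : (V8 → V8) → F3 → V8 → V8
pow f zero x = x
pow f (suc zero) x = f x
pow f (suc (suc zero)) x = f (f x)

F3⁴ : Set
F3⁴ = Vec F3 4

-- A_λ = ζ_a^i ⊕ ζ_b^j ⊕ ζ_c^k ⊕ ζ_d^l (the factors commute, acting on
-- different components).
A : F3⁴ → V8 → V8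
A (i ∷ j ∷ k ∷ l ∷ []) x = pow ζa i (pow ζb j (pow ζc k (pow ζd l x)))

double₃ : F3 → F3
double₃ zero = zero
double₃ (suc zero) = suc (suc zero)
double₃ (suc (suc zero)) = suc zero

neg₃ : F3 → F3
neg₃ zero = zero
neg₃ (suc zero) = suc (suc zero)
neg₃ (suc (suc zero)) = suc zero

2·_ : F3⁴ → F3⁴
2· v = map double₃ v

-_ : F3⁴ → F3⁴
- v = map neg₃ v

zero₄ : F3⁴
zero₄ = replicate 4 zero

IsLine : V8 → V8 → V8 → Set
IsLine p q r =
  IsPoint p × IsPoint q × IsPoint r ×
  p ≢ q × q ≢ r × p ≢ r × (p ⊕ q ⊕ r ≡ zeroV)

private
  ₀ ₁ ₂ : F3
  ₀ = zero
  ₁ = suc zero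
  ₂ = suc (suc zero)

Ξ : List F3⁴
Ξ = (₁ ∷ ₁ ∷ ₁ ∷ ₁ ∷ []) ∷ (₁ ∷ ₂ ∷ ₂ ∷ ₁ ∷ []) ∷
    (₂ ∷ ₁ ∷ ₂ ∷ ₁ ∷ []) ∷ (₂ ∷ ₂ ∷ ₁ ∷ ₁ ∷ []) ∷ []

Ξ* : List F3⁴
Ξ* = (₂ ∷ ₂ ∷ ₂ ∷ ₁ ∷ []) ∷ (₂ ∷ ₁ ∷ ₁ ∷ ₁ ∷ []) ∷
     (₁ ∷ ₂ ∷ ₁ ∷ ₁ ∷ []) ∷ (₁ ∷ ₁ ∷ ₂ ∷ ₁ ∷ []) ∷ []

-- Split V₈ into the four planes V_a, …, V_d. In suitable bases each ζ_h acts on its plane as the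
-- same map ρ (u , v) = (v , u + v) of order 3, which permutes the three nonzero vectors of F₂²
-- cyclically. Hence for p ∈ ω₄ each plane-component of p + A_λ p + A_2λ p is x + ρⁱx + ρ²ⁱx with
-- x ≠ 0: for i ≠ 0 this is the sum of all nonzero vectors of F₂², namely 0, and for i = 0 it is
-- x ≠ 0. The other conditions hold automatically since ρ preserves nonzero vectors, and three
-- nonzero vectors of sum 0 are distinct. So the left side says exactly that λ has no zero
-- coordinate, and so does the right side: Ξ ∪ Ξ* are the eight such λ with last coordinate 1.
module Submission where

open import Defs
open import Data.Bool using (Bool; true; false; _xor_)
open import Data.Bool.Properties using (xor-same; xor-comm; xor-assoc; xor-identityˡ; xor-identityʳ)
open import Data.Empty using (⊥-elim)
open import Data.Fin using (zero; suc)
import Data.Fin.Properties as Fin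
open import Data.List using (_++_)
open import Data.List.Membership.Propositional using (_∈_)
import Data.List.Relation.Unary.All as ListAll
open import Data.Product using (_×_; _,_; proj₁; proj₂)
open import Data.Sum using (_⊎_; inj₁; inj₂; swap)
open import Data.Vec using (Vec; []; _∷_; replicate; zipWith)
open import Data.Vec.Properties using (≡-dec; ∷-injective; zipWith-assoc; zipWith-comm; zipWith-identityˡ; zipWith-identityʳ)
open import Data.Vec.Relation.Unary.All using (All; []; _∷_)
import Data.Vec.Relation.Unary.All as All
open import Data.Vec.Relation.Unary.All.Properties using (map⁻)
open import Data.List.Membership.DecPropositional {A = F3⁴} (≡-dec Fin._≟_) using (_∈?_)
open import Function.Base using (_∘_)
open import Function.Bundles using (_⇔_; mk⇔; Equivalence)
import Function.Properties.Equivalence as ⇔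
open import Relation.Nullary using (Dec; ¬?; _→-dec_)
open import Relation.Nullary.Decidable using (from-yes)
open import Relation.Binary.PropositionalEquality using (_≡_; _≢_; refl; sym; trans; cong; cong₂; module ≡-Reasoning)

V₂ : Set
V₂ = Bool × Bool

0₂ : V₂
0₂ = false , false

_+₂_ : V₂ → V₂ → V₂
(u , v) +₂ (u′ , v′) = u xor u′ , v xor v′

infixl 6 _+₂_

Nonzero : V₂ → Set
Nonzero x = x ≢ 0₂

ρ : V₂ → V₂
ρ (u , v) = v , u xor v

ρ^_ : F3 → V₂ → V₂
(ρ^ zero) x = x
(ρ^ suc zero) x = ρ x
(ρ^ suc (suc zero)) x = ρ (ρ x)

orbitSum : F3 → V₂ → V₂
orbitSum i x = x +₂ (ρ^ i) x +₂ (ρ^ double₃ i) x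

ρ-nonzero : ∀ {x} → Nonzero x → Nonzero (ρ x)
ρ-nonzero {false , false} x≢0 = ⊥-elim (x≢0 refl)
ρ-nonzero {false , true} _ ()
ρ-nonzero {true , false} _ ()
ρ-nonzero {true , true} _ ()

ρ^-nonzero : ∀ i {x} → Nonzero x → Nonzero ((ρ^ i) x)
ρ^-nonzero zero x≢0 = x≢0
ρ^-nonzero (suc zero) x≢0 = ρ-nonzero x≢0
ρ^-nonzero (suc (suc zero)) x≢0 = ρ-nonzero (ρ-nonzero x≢0)

orbitSum-zero : ∀ x → orbitSum zero x ≡ x
orbitSum-zero (u , v) = cong₂ _,_ (cong (_xor u) (xor-same u)) (cong (_xor v) (xor-same v))

orbitSum-unit : ∀ i x → i ≢ zero → orbitSum i x ≡ 0₂
orbitSum-unit zero x i≢0 = ⊥-elim (i≢0 refl)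
orbitSum-unit (suc zero) (u , v) _ = cong₂ _,_ (xor-same (u xor v)) (xor-same (v xor (u xor v)))
orbitSum-unit (suc (suc zero)) (false , false) _ = refl
orbitSum-unit (suc (suc zero)) (false , true) _ = refl
orbitSum-unit (suc (suc zero)) (true , false) _ = refl
orbitSum-unit (suc (suc zero)) (true , true) _ = refl

orbitSum≡0⇔unit : ∀ {i x} → Nonzero x → (orbitSum i x ≡ 0₂) ⇔ (i ≢ zero)
orbitSum≡0⇔unit {i} {x} x≢0 = mk⇔
  (λ { s refl → x≢0 (trans (sym (orbitSum-zero x)) s) })
  (orbitSum-unit i x)

nonzeroPair⇔nonzero : ∀ {u v} → NonzeroPair u v ⇔ Nonzero (u , v)
nonzeroPair⇔nonzero = mk⇔ (λ { (inj₁ refl) () ; (inj₂ refl) () }) from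
  where
  from : ∀ {u v} → Nonzero (u , v) → NonzeroPair u v
  from {true} _ = inj₁ refl
  from {false} {true} _ = inj₂ refl
  from {false} {false} x≢0 = ⊥-elim (x≢0 refl)

-- Coordinates on V_a, V_b, V_c, V_d in the bases (e₁,e₈), (e₇,e₂), (e₃,e₆), (e₅,e₄),
-- in which every ζ_h acts as ρ.
glue : Vec V₂ 4 → V8
glue ((x1 , x8) ∷ (x7 , x2) ∷ (x3 , x6) ∷ (x5 , x4) ∷ []) =
  x1 ∷ x2 ∷ x3 ∷ x4 ∷ x5 ∷ x6 ∷ x7 ∷ x8 ∷ []

components : V8 → Vec V₂ 4
components (x1 ∷ x2 ∷ x3 ∷ x4 ∷ x5 ∷ x6 ∷ x7 ∷ x8 ∷ []) =
  (x1 , x8) ∷ (x7 , x2) ∷ (x3 , x6) ∷ (x5 , x4) ∷ []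

glue-components : ∀ p → glue (components p) ≡ p
glue-components (x1 ∷ x2 ∷ x3 ∷ x4 ∷ x5 ∷ x6 ∷ x7 ∷ x8 ∷ []) = refl

components-glue : ∀ w → components (glue w) ≡ w
components-glue (a ∷ b ∷ c ∷ d ∷ []) = refl

glue-injective : ∀ {v w} → glue v ≡ glue w → v ≡ w
glue-injective {v} {w} eq = begin
  v                    ≡⟨ sym (components-glue v) ⟩
  components (glue v)  ≡⟨ cong components eq ⟩
  components (glue w)  ≡⟨ components-glue w ⟩
  w                    ∎
  where open ≡-Reasoning

pow-ζa : ∀ i a b c d → pow ζa i (glue (a ∷ b ∷ c ∷ d ∷ [])) ≡ glue ((ρ^ i) a ∷ b ∷ c ∷ d ∷ [])
pow-ζa zero a b c d = refl
pow-ζa (suc zero) a b c d = refl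
pow-ζa (suc (suc zero)) a b c d = refl

pow-ζc : ∀ k a b c d → pow ζc k (glue (a ∷ b ∷ c ∷ d ∷ [])) ≡ glue (a ∷ b ∷ (ρ^ k) c ∷ d ∷ [])
pow-ζc zero a b c d = refl
pow-ζc (suc zero) a b c d = refl
pow-ζc (suc (suc zero)) a b c d = refl

-- ζ_b and ζ_d are written with x₂ + x₇ and x₄ + x₅, where ρ produces x₇ + x₂ and x₅ + x₄.
ρ-swapped : ∀ u v → ρ (u , v) ≡ (v , v xor u)
ρ-swapped u v = cong (v ,_) (xor-comm u v)

ρ²-swapped : ∀ u v → ρ (ρ (u , v)) ≡ (v xor u , (v xor u) xor v)
ρ²-swapped u v = cong₂ _,_ (xor-comm u v) (trans (xor-comm v (u xor v)) (cong (_xor v) (xor-comm u v)))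

pow-ζb : ∀ j a b c d → pow ζb j (glue (a ∷ b ∷ c ∷ d ∷ [])) ≡ glue (a ∷ (ρ^ j) b ∷ c ∷ d ∷ [])
pow-ζb zero a b c d = refl
pow-ζb (suc zero) a (u , v) c d = cong (λ y → glue (a ∷ y ∷ c ∷ d ∷ [])) (sym (ρ-swapped u v))
pow-ζb (suc (suc zero)) a (u , v) c d = cong (λ y → glue (a ∷ y ∷ c ∷ d ∷ [])) (sym (ρ²-swapped u v))

pow-ζd : ∀ l a b c d → pow ζd l (glue (a ∷ b ∷ c ∷ d ∷ [])) ≡ glue (a ∷ b ∷ c ∷ (ρ^ l) d ∷ [])
pow-ζd zero a b c d = refl
pow-ζd (suc zero) a b c (u , v) = cong (λ y → glue (a ∷ b ∷ c ∷ y ∷ [])) (sym (ρ-swapped u v))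
pow-ζd (suc (suc zero)) a b c (u , v) = cong (λ y → glue (a ∷ b ∷ c ∷ y ∷ [])) (sym (ρ²-swapped u v))

_⋆_ : ∀ {n} → Vec F3 n → Vec V₂ n → Vec V₂ n
_⋆_ = zipWith ρ^_

A-glue : ∀ λ' w → A λ' (glue w) ≡ glue (λ' ⋆ w)
A-glue (i ∷ j ∷ k ∷ l ∷ []) (a ∷ b ∷ c ∷ d ∷ []) = begin
  pow ζa i (pow ζb j (pow ζc k (pow ζd l (glue (a ∷ b ∷ c ∷ d ∷ [])))))
    ≡⟨ cong (pow ζa i ∘ pow ζb j ∘ pow ζc k) (pow-ζd l a b c d) ⟩
  pow ζa i (pow ζb j (pow ζc k (glue (a ∷ b ∷ c ∷ d′ ∷ []))))
    ≡⟨ cong (pow ζa i ∘ pow ζb j) (pow-ζc k a b c d′) ⟩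
  pow ζa i (pow ζb j (glue (a ∷ b ∷ c′ ∷ d′ ∷ [])))
    ≡⟨ cong (pow ζa i) (pow-ζb j a b c′ d′) ⟩
  pow ζa i (glue (a ∷ b′ ∷ c′ ∷ d′ ∷ []))
    ≡⟨ pow-ζa i a b′ c′ d′ ⟩
  glue ((ρ^ i) a ∷ b′ ∷ c′ ∷ d′ ∷ [])
    ∎
  where
  open ≡-Reasoning
  b′ c′ d′ : V₂
  b′ = (ρ^ j) b
  c′ = (ρ^ k) c
  d′ = (ρ^ l) d

orbitSum-glue : ∀ λ' w → glue w ⊕ glue (λ' ⋆ w) ⊕ glue ((2· λ') ⋆ w) ≡ glue (zipWith orbitSum λ' w)
orbitSum-glue (i ∷ j ∷ k ∷ l ∷ []) (a ∷ b ∷ c ∷ d ∷ []) = refl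

ω₄-glue⇔ : ∀ w → ω₄ (glue w) ⇔ All Nonzero w
ω₄-glue⇔ (a ∷ b ∷ c ∷ d ∷ []) = mk⇔
  (λ (na , nb , nc , nd) → to na ∷ to (swap nb) ∷ to nc ∷ to (swap nd) ∷ [])
  (λ { (na ∷ nb ∷ nc ∷ nd ∷ []) → from na , swap (from nb) , from nc , swap (from nd) })
  where
  to : ∀ {u v} → NonzeroPair u v → Nonzero (u , v)
  to = Equivalence.to nonzeroPair⇔nonzero
  from : ∀ {u v} → Nonzero (u , v) → NonzeroPair u v
  from = Equivalence.from nonzeroPair⇔nonzero

≡replicate⇔All≡ : ∀ {A : Set} {n} {x : A} (xs : Vec A n) → (xs ≡ replicate n x) ⇔ All (_≡ x) xs
≡replicate⇔All≡ [] = mk⇔ (λ _ → []) (λ _ → refl)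
≡replicate⇔All≡ (y ∷ ys) = mk⇔
  (λ eq → proj₁ (∷-injective eq) ∷ Equivalence.to (≡replicate⇔All≡ ys) (proj₂ (∷-injective eq)))
  (λ { (y≡x ∷ ys≡x) → cong₂ _∷_ y≡x (Equivalence.from (≡replicate⇔All≡ ys) ys≡x) })

glue≡0⇔ : ∀ w → (glue w ≡ zeroV) ⇔ All (_≡ 0₂) w
glue≡0⇔ w = ⇔.trans (mk⇔ glue-injective (cong glue)) (≡replicate⇔All≡ w)

glue-isPoint : ∀ {w} → All Nonzero w → IsPoint (glue w)
glue-isPoint {w} (a≢0 ∷ _) eq with Equivalence.to (glue≡0⇔ w) eq
... | a≡0 ∷ _ = a≢0 a≡0

⊕-self : ∀ {n} (x : Vec Bool n) → zipWith _xor_ x x ≡ replicate n false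
⊕-self [] = refl
⊕-self (b ∷ x) = cong₂ _∷_ (xor-same b) (⊕-self x)

⊕-cancelˡ : ∀ x y → x ⊕ x ⊕ y ≡ y
⊕-cancelˡ x y = trans (cong (_⊕ y) (⊕-self x)) (zipWith-identityˡ xor-identityˡ y)

⊕-cancelʳ : ∀ x y → x ⊕ y ⊕ y ≡ x
⊕-cancelʳ x y = begin
  x ⊕ y ⊕ y    ≡⟨ zipWith-assoc xor-assoc x y y ⟩
  x ⊕ (y ⊕ y)  ≡⟨ cong (x ⊕_) (⊕-self y) ⟩
  x ⊕ zeroV    ≡⟨ zipWith-identityʳ xor-identityʳ x ⟩
  x            ∎
  where open ≡-Reasoning

sum≡0⇒isLine : ∀ {p q r} → IsPoint p → IsPoint q → IsPoint r → p ⊕ q ⊕ r ≡ zeroV → IsLine p q r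
sum≡0⇒isLine {p} {q} {r} p≢0 q≢0 r≢0 s = p≢0 , q≢0 , r≢0 , p≢q , q≢r , p≢r , s
  where
  p≢q : p ≢ q
  p≢q refl = r≢0 (trans (sym (⊕-cancelˡ p r)) s)
  q≢r : q ≢ r
  q≢r refl = p≢0 (trans (sym (⊕-cancelʳ p q)) s)
  p≢r : p ≢ r
  p≢r refl = q≢0 (trans (sym (trans (cong (_⊕ p) (zipWith-comm xor-comm p q)) (⊕-cancelʳ q p))) s)

Units : ∀ {n} → Vec F3 n → Set
Units = All (_≢ zero)

orbitSums≡0⇔units : ∀ {n} {λ' : Vec F3 n} {w} → All Nonzero w → All (_≡ 0₂) (zipWith orbitSum λ' w) ⇔ Units λ'
orbitSums≡0⇔units {λ' = []} {[]} [] = mk⇔ (λ _ → []) (λ _ → [])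
orbitSums≡0⇔units {λ' = i ∷ λ'} {x ∷ w} (x≢0 ∷ w≢0) = mk⇔
  (λ { (s ∷ ss) → Equivalence.to (orbitSum≡0⇔unit x≢0) s ∷ Equivalence.to (orbitSums≡0⇔units w≢0) ss })
  (λ { (u ∷ us) → Equivalence.from (orbitSum≡0⇔unit x≢0) u ∷ Equivalence.from (orbitSums≡0⇔units w≢0) us })

⋆-nonzero : ∀ {n} (λ' : Vec F3 n) {w} → All Nonzero w → All Nonzero (λ' ⋆ w)
⋆-nonzero [] [] = []
⋆-nonzero (i ∷ λ') (x≢0 ∷ w≢0) = ρ^-nonzero i x≢0 ∷ ⋆-nonzero λ' w≢0

line-in-ω₄⇔units : ∀ λ' w → All Nonzero w →
  (IsLine (glue w) (A λ' (glue w)) (A (2· λ') (glue w))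
    × ω₄ (glue w) × ω₄ (A λ' (glue w)) × ω₄ (A (2· λ') (glue w)))
  ⇔ Units λ'
line-in-ω₄⇔units λ' w w≢0 rewrite A-glue λ' w | A-glue (2· λ') w = mk⇔
  (λ ((_ , _ , _ , _ , _ , _ , s) , _) → Equivalence.to sum≡0⇔units s)
  (λ u → sum≡0⇒isLine (glue-isPoint w≢0) (glue-isPoint λw≢0) (glue-isPoint 2λw≢0)
                      (Equivalence.from sum≡0⇔units u)
       , ω₄⁺ w≢0 , ω₄⁺ λw≢0 , ω₄⁺ 2λw≢0)
  where
  λw≢0 : All Nonzero (λ' ⋆ w)
  λw≢0 = ⋆-nonzero λ' w≢0
  2λw≢0 : All Nonzero ((2· λ') ⋆ w)
  2λw≢0 = ⋆-nonzero (2· λ') w≢0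
  ω₄⁺ : ∀ {v} → All Nonzero v → ω₄ (glue v)
  ω₄⁺ {v} = Equivalence.from (ω₄-glue⇔ v)
  sum≡0⇔units : (glue w ⊕ glue (λ' ⋆ w) ⊕ glue ((2· λ') ⋆ w) ≡ zeroV) ⇔ Units λ'
  sum≡0⇔units rewrite orbitSum-glue λ' w =
    ⇔.trans (glue≡0⇔ (zipWith orbitSum λ' w)) (orbitSums≡0⇔units w≢0)

units? : ∀ {n} (λ' : Vec F3 n) → Dec (Units λ')
units? = All.all? (λ i → ¬? (i Fin.≟ zero))

neg₃-unit : ∀ {i} → i ≢ zero → neg₃ i ≢ zero
neg₃-unit {zero} i≢0 = ⊥-elim (i≢0 refl)
neg₃-unit {suc zero} _ ()
neg₃-unit {suc (suc zero)} _ ()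

neg₃-unit⁻ : ∀ {i} → neg₃ i ≢ zero → i ≢ zero
neg₃-unit⁻ u refl = u refl

Ξ∪Ξ*-units : ∀ {λ'} → λ' ∈ Ξ ++ Ξ* → Units λ'
Ξ∪Ξ*-units = ListAll.lookup (from-yes (ListAll.all? units? (Ξ ++ Ξ*)))

unit-last-one∈Ξ∪Ξ* : ∀ i j k → Units (i ∷ j ∷ k ∷ []) → (i ∷ j ∷ k ∷ suc zero ∷ []) ∈ Ξ ++ Ξ*
unit-last-one∈Ξ∪Ξ* = from-yes
  (Fin.all? λ i → Fin.all? λ j → Fin.all? λ k →
    units? (i ∷ j ∷ k ∷ []) →-dec ((i ∷ j ∷ k ∷ suc zero ∷ []) ∈? (Ξ ++ Ξ*)))

Ξ∪Ξ*±⇔units : ∀ λ' → ((λ' ∈ Ξ ++ Ξ*) ⊎ ((- λ') ∈ Ξ ++ Ξ*)) ⇔ Units λ'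
Ξ∪Ξ*±⇔units λ' = mk⇔
  (λ { (inj₁ m) → Ξ∪Ξ*-units m ; (inj₂ m) → All.map neg₃-unit⁻ (map⁻ (Ξ∪Ξ*-units m)) })
  (from λ')
  where
  from : ∀ λ' → Units λ' → (λ' ∈ Ξ ++ Ξ*) ⊎ ((- λ') ∈ Ξ ++ Ξ*)
  from (i ∷ j ∷ k ∷ zero ∷ []) (_ ∷ _ ∷ _ ∷ l≢0 ∷ []) = ⊥-elim (l≢0 refl)
  from (i ∷ j ∷ k ∷ suc zero ∷ []) (ui ∷ uj ∷ uk ∷ _) = inj₁ (unit-last-one∈Ξ∪Ξ* i j k (ui ∷ uj ∷ uk ∷ []))
  from (i ∷ j ∷ k ∷ suc (suc zero) ∷ []) (ui ∷ uj ∷ uk ∷ _) =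
    inj₂ (unit-last-one∈Ξ∪Ξ* (neg₃ i) (neg₃ j) (neg₃ k) (neg₃-unit ui ∷ neg₃-unit uj ∷ neg₃-unit uk ∷ []))

lemma2 : (p : V8) → ω₄ p → (λ' : F3⁴) → λ' ≢ zero₄ →
    ((IsLine p (A λ' p) (A (2· λ') p) × ω₄ p × ω₄ (A λ' p) × ω₄ (A (2· λ') p))
      ⇔ ((λ' ∈ Ξ ++ Ξ*) ⊎ ((- λ') ∈ Ξ ++ Ξ*)))
lemma2 p ωp λ' _ = ⇔.trans line⇔units (⇔.sym (Ξ∪Ξ*±⇔units λ'))
  where
  line⇔units : (IsLine p (A λ' p) (A (2· λ') p) × ω₄ p × ω₄ (A λ' p) × ω₄ (A (2· λ') p)) ⇔ Units λ'
  line⇔units rewrite sym (glue-components p) =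
    line-in-ω₄⇔units λ' (components p) (Equivalence.to (ω₄-glue⇔ (components p)) ωp)
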